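{- For every drawing $D$ of a graph $G$, the planarisation $P_D$ of $D$ satisfies $\operatorname{tw}(G)\le 2\operatorname{tw}(P_D)+1$ and $\operatorname{tw}(X_D)\le 2\operatorname{tw}(P_D)+1$, where $X_D$ is the crossing graph of $D$.
   Context: A drawing of a graph $G$ maps vertices to distinct points of $\mathbb{R}^2$ and each edge $vw$ to a non-self-intersecting curve between the images of $v$ and $w$, such that no edge curve passes through the image of a non-incident vertex, any two edge curves meet in finitely many points, and no three edges share an internal intersection point. A crossing is an intersection point of two distinct edges other than their endpoints. The crossing graph $X_D$ has vertex set $E(G)$ and, for each crossing of $e$ and $f$, an edge between $e$ and $f$. The planarisation $P_D$ is the plane graph obtained by replacing each crossing by a new dummy vertex of degree $4$. -}

module Defs where

open import Data.Nat using (ℕ; suc; _≤_; _+_; _*_)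
open import Data.Fin using (Fin; toℕ)
open import Data.Product using (Σ; ∃; _×_; _,_)
open import Data.Sum using (_⊎_; inj₁; inj₂)
open import Data.List using (List; []; _∷_; length; map; _++_)
open import Data.List.Membership.Propositional using (_∈_)
open import Data.List.Relation.Unary.Unique.Propositional using (Unique)
open import Relation.Binary.PropositionalEquality using (_≡_; _≢_)
open import Function.Bundles using (_⇔_)

data Walk {A : Set} (R : A → A → Set) (P : A → Set) : A → A → Set where
  stop : ∀ {x} → P x → Walk R P x x
  step : ∀ {x y z} → P x → R x y → Walk R P y z → Walk R P x z

-- A tree on nodes Fin (suc t), encoded by parent pointers: node
-- (suc i) has parent (parent i), whose index is ≤ i (node 0 is the root).
-- Every finite tree admits such a labelling.
TreeAdj : {t : ℕ} → (Fin t → Fin (suc t)) → Fin (suc t) → Fin (suc t) → Set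
TreeAdj {t} parent x y =
  Σ (Fin t) λ i → (x ≡ Fin.suc i × y ≡ parent i) ⊎ (y ≡ Fin.suc i × x ≡ parent i)

record TreeDecomposition {V : Set} (Adj : V → V → Set) (k : ℕ) : Set where
  field
    t        : ℕ
    parent   : Fin t → Fin (suc t)
    parent≤  : ∀ i → toℕ (parent i) ≤ toℕ i
    bag      : Fin (suc t) → List V
    bagSize  : ∀ x → length (bag x) ≤ suc k
    covers   : ∀ v → ∃ λ x → v ∈ bag x
    edgeBag  : ∀ u v → Adj u v → ∃ λ x → (u ∈ bag x × v ∈ bag x)
    subtree  : ∀ v x y → v ∈ bag x → v ∈ bag y →
               Walk (TreeAdj parent) (λ z → v ∈ bag z) x y

TwAtMost : {V : Set} → (V → V → Set) → ℕ → Set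
TwAtMost Adj k = TreeDecomposition Adj k

record Graph : Set where
  field
    n m      : ℕ
    src tgt  : Fin m → Fin n
    loopless : ∀ e → src e ≢ tgt e
    simple   : ∀ e f → ((src e ≡ src f × tgt e ≡ tgt f) ⊎ (src e ≡ tgt f × tgt e ≡ src f)) → e ≡ f

GAdj : (G : Graph) → Fin (Graph.n G) → Fin (Graph.n G) → Set
GAdj G u v = Σ (Fin m) λ e → (src e ≡ u × tgt e ≡ v) ⊎ (src e ≡ v × tgt e ≡ u)
  where open Graph G

-- Drawings, recorded by their combinatorial data:
-- c crossings, crossing j is between the distinct edges cr₁ j and cr₂ j,
-- and for each edge e, along e (from src e to tgt e) the crossings on e
-- appear in the order given by the list `along e`.

record Drawing (G : Graph) : Set where
  open Graph G
  field
    c         : ℕ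
    cr₁ cr₂   : Fin c → Fin m
    distinct  : ∀ j → cr₁ j ≢ cr₂ j
    along     : Fin m → List (Fin c)
    alongUniq : ∀ e → Unique (along e)
    alongOK   : ∀ e j → (j ∈ along e) ⇔ (cr₁ j ≡ e ⊎ cr₂ j ≡ e)

data Consec {A : Set} : List A → A → A → Set where
  here  : ∀ {x y xs} → Consec (x ∷ y ∷ xs) x y
  there : ∀ {z xs x y} → Consec xs x y → Consec (z ∷ xs) x y

module _ {G : Graph} (D : Drawing G) where
  open Graph G
  open Drawing D

  PVertex : Set
  PVertex = Fin n ⊎ Fin c

  -- The path that replaces edge e in the planarisation.
  edgePath : Fin m → List PVertex
  edgePath e = inj₁ (src e) ∷ (map inj₂ (along e) ++ (inj₁ (tgt e) ∷ []))

  PAdj : PVertex → PVertex → Set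
  PAdj x y = Σ (Fin m) λ e → Consec (edgePath e) x y ⊎ Consec (edgePath e) y x

  XAdj : Fin m → Fin m → Set
  XAdj e f = Σ (Fin c) λ j → (cr₁ j ≡ e × cr₂ j ≡ f) ⊎ (cr₁ j ≡ f × cr₂ j ≡ e)

-- Let every vertex of P_D carry at most two vertices of the target graph: a crossing of the
-- edges e and f carries their source vertices (for G) or e and f themselves (for X_D), and an
-- original vertex carries itself (for G) or nothing (for X_D). For each target vertex the
-- vertices of P_D carrying it form a connected subgraph, and adjacent target vertices are carried
-- by equal or adjacent vertices of P_D. Replacing every bag of a decomposition of P_D of width k
-- by what its members carry therefore yields a decomposition of width at most 2(k+1) - 1, except
-- that vertices carried by nothing (edges without crossings, isolated in X_D) get leaves of
-- their own.
module Submission where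

open import Defs
open import Data.Nat using (ℕ; suc; _+_; _*_; _≤_; z≤n; s≤s)
open import Data.Nat.Properties using (≤-trans; ≤-reflexive; +-comm; *-suc; +-mono-≤; *-monoʳ-≤)
open import Data.Fin as Fin using (Fin; toℕ; _↑ˡ_; _↑ʳ_; splitAt; _≟_)
open import Data.Fin.Properties using (toℕ-↑ˡ; splitAt-↑ˡ; splitAt-↑ʳ; splitAt⁻¹-↑ˡ; splitAt⁻¹-↑ʳ; any?)
open import Data.Product using (∃; ∃₂; _×_; _,_)
open import Data.Sum as Sum using (_⊎_; inj₁; inj₂; [_,_]′)
open import Data.List using (List; []; _∷_; [_]; length; map; _++_; concatMap)
open import Data.List.Properties using (length-++)
open import Data.List.Membership.Propositional using (_∈_; find; lose)
open import Data.List.Membership.Propositional.Properties using (∈-map⁺; ∈-map⁻; ∈-concatMap⁺; ∈-concatMap⁻)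
import Data.List.Membership.DecPropositional as DecMembership
open import Data.List.Relation.Unary.Any using (here; there)
open import Data.Empty using (⊥-elim)
open import Function using (id; _∘_)
open import Function.Bundles using (Equivalence)
open import Relation.Nullary using (¬_; Dec; yes; no)
open import Relation.Binary.PropositionalEquality using (_≡_; refl; sym; trans; cong; subst)

mapWalk : {A B : Set} {R : A → A → Set} {P : A → Set} {R′ : B → B → Set} {P′ : B → Set}
          (g : A → B) → (∀ {x y} → R x y → R′ (g x) (g y)) → (∀ {x} → P x → P′ (g x)) →
          ∀ {x y} → Walk R P x y → Walk R′ P′ (g x) (g y)
mapWalk g r p (stop px)      = stop (p px)
mapWalk g r p (step px xy w) = step (p px) (r xy) (mapWalk g r p w)

module _ {A : Set} {R : A → A → Set} {P : A → Set} where

  infixr 5 _◅◅_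

  _◅◅_ : ∀ {x y z} → Walk R P x y → Walk R P y z → Walk R P x z
  stop _       ◅◅ w′ = w′
  step px xy w ◅◅ w′ = step px xy (w ◅◅ w′)

  start : ∀ {x y} → Walk R P x y → P x
  start (stop px)     = px
  start (step px _ _) = px

  reverseWalk : (∀ {x y} → R x y → R y x) → ∀ {x y} → Walk R P x y → Walk R P y x
  reverseWalk R-sym (stop px)      = stop px
  reverseWalk R-sym (step px xy w) = reverseWalk R-sym w ◅◅ step (start w) (R-sym xy) (stop px)

record PreTreeDecomposition {V : Set} (Adj : V → V → Set) (k : ℕ) : Set where
  field
    t        : ℕ
    parent   : Fin t → Fin (suc t)
    parent≤  : ∀ i → toℕ (parent i) ≤ toℕ i
    bag      : Fin (suc t) → List V
    bagSize  : ∀ x → length (bag x) ≤ suc k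
    edgeBag  : ∀ u v → Adj u v → ∃ λ x → (u ∈ bag x × v ∈ bag x)
    subtree  : ∀ v x y → v ∈ bag x → v ∈ bag y →
               Walk (TreeAdj parent) (λ z → v ∈ bag z) x y

-- The branch set of w is the set of vertices p with w ∈ carried p.
record Model {P W : Set} (PAdj : P → P → Set) (WAdj : W → W → Set) (r : ℕ) : Set where
  field
    carried         : P → List W
    load            : ∀ p → length (carried p) ≤ r
    branchConnected : ∀ w p q → w ∈ carried p → w ∈ carried q →
                      Walk PAdj (λ z → w ∈ carried z) p q
    branchesTouch   : ∀ u v → WAdj u v →
                      ∃₂ λ p q → u ∈ carried p × v ∈ carried q × (p ≡ q ⊎ PAdj p q)

length-concatMap≤ : {A B : Set} (f : A → List B) {r : ℕ} → (∀ x → length (f x) ≤ r) →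
                    ∀ xs → length (concatMap f xs) ≤ r * length xs
length-concatMap≤ f         f≤r []       = z≤n
length-concatMap≤ f {r} f≤r (x ∷ xs) = begin
  length (f x ++ concatMap f xs)           ≡⟨ length-++ (f x) ⟩
  length (f x) + length (concatMap f xs)   ≤⟨ +-mono-≤ (f≤r x) (length-concatMap≤ f f≤r xs) ⟩
  r + r * length xs                        ≡⟨ *-suc r (length xs) ⟨
  r * suc (length xs)                      ∎
  where open Data.Nat.Properties.≤-Reasoning

module _ {P W : Set} {PAdj : P → P → Set} {WAdj : W → W → Set} {k r : ℕ}
         (T : TreeDecomposition PAdj k) (M : Model PAdj WAdj r) where
  open TreeDecomposition T
  open Model M

  carriedBag : Fin (suc t) → List W
  carriedBag x = concatMap carried (bag x)

  ∈-carriedBag : ∀ {w p x} → p ∈ bag x → w ∈ carried p → w ∈ carriedBag x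
  ∈-carriedBag p∈x w∈p = ∈-concatMap⁺ carried (lose p∈x w∈p)

  subtreeCarrying : ∀ {w p x y} → w ∈ carried p → p ∈ bag x → p ∈ bag y →
                    Walk (TreeAdj parent) (λ z → w ∈ carriedBag z) x y
  subtreeCarrying w∈p p∈x p∈y = mapWalk id id (λ p∈z → ∈-carriedBag p∈z w∈p) (subtree _ _ _ p∈x p∈y)

  -- Each step pq of the branch-set walk is covered by a bag containing p and q, through which
  -- the subtrees of p and q are glued.
  liftBranchWalk : ∀ {w p q x y} → Walk PAdj (λ z → w ∈ carried z) p q → p ∈ bag x → q ∈ bag y →
                   Walk (TreeAdj parent) (λ z → w ∈ carriedBag z) x y
  liftBranchWalk (stop w∈p) p∈x p∈y = subtreeCarrying w∈p p∈x p∈y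
  liftBranchWalk (step w∈p pp′ walk) p∈x q∈y with edgeBag _ _ pp′
  ... | z , p∈z , p′∈z = subtreeCarrying w∈p p∈x p∈z ◅◅ liftBranchWalk walk p′∈z q∈y

  carriedEdgeBag : ∀ u v → WAdj u v → ∃ λ x → u ∈ carriedBag x × v ∈ carriedBag x
  carriedEdgeBag u v uv with branchesTouch u v uv
  ... | p , .p , u∈p , v∈p , inj₁ refl with covers p
  ...   | x , p∈x = x , ∈-carriedBag p∈x u∈p , ∈-carriedBag p∈x v∈p
  carriedEdgeBag u v uv | p , q , u∈p , v∈q , inj₂ pq with edgeBag p q pq
  ...   | x , p∈x , q∈x = x , ∈-carriedBag p∈x u∈p , ∈-carriedBag q∈x v∈q

  carriedSubtree : ∀ w x y → w ∈ carriedBag x → w ∈ carriedBag y →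
                   Walk (TreeAdj parent) (λ z → w ∈ carriedBag z) x y
  carriedSubtree w x y w∈x w∈y with find (∈-concatMap⁻ carried w∈x) | find (∈-concatMap⁻ carried w∈y)
  ... | p , p∈x , w∈p | q , q∈y , w∈q = liftBranchWalk (branchConnected w p q w∈p w∈q) p∈x q∈y

  carriedDecomposition : ∀ {K} → r * suc k ≤ suc K → PreTreeDecomposition WAdj K
  carriedDecomposition rk≤K = record
    { t        = t
    ; parent   = parent
    ; parent≤  = parent≤
    ; bag      = carriedBag
    ; bagSize  = λ x → ≤-trans (length-concatMap≤ carried load (bag x))
                               (≤-trans (*-monoʳ-≤ r (bagSize x)) rk≤K)
    ; edgeBag  = carriedEdgeBag
    ; subtree  = carriedSubtree
    }

data SplitView (p q : ℕ) : Fin (p + q) → Set where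
  inˡ : ∀ x → SplitView p q (x ↑ˡ q)
  inʳ : ∀ y → SplitView p q (p ↑ʳ y)

splitView : ∀ p {q} (z : Fin (p + q)) → SplitView p q z
splitView p {q} z with splitAt p z in eq
... | inj₁ x = subst (SplitView p q) (splitAt⁻¹-↑ˡ eq) (inˡ x)
... | inj₂ y = subst (SplitView p q) (splitAt⁻¹-↑ʳ eq) (inʳ y)

[_]-unless_ : {A B : Set} → B → Dec A → List B
[ b ]-unless yes _ = []
[ b ]-unless no _  = [ b ]

∈-unless : {A B : Set} {b v : B} (a? : Dec A) → v ∈ [ b ]-unless a? → v ≡ b × ¬ A
∈-unless (no ¬a) (here refl) = refl , ¬a

length-unless : {A B : Set} {b : B} (a? : Dec A) → length ([ b ]-unless a?) ≤ 1
length-unless (yes _) = z≤n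
length-unless (no _)  = s≤s z≤n

module _ {m K : ℕ} {Adj : Fin m → Fin m → Set} (T : PreTreeDecomposition Adj K) where
  open PreTreeDecomposition T
  open DecMembership (_≟_ {m}) using (_∈?_)

  covered? : ∀ w → Dec (∃ λ x → w ∈ bag x)
  covered? w = any? (λ x → w ∈? bag x)

  -- Node suc t ↑ʳ w is a leaf of the root, with bag [ w ] if w is in no old bag and [] otherwise.
  extParent : Fin (t + m) → Fin (suc (t + m))
  extParent i = [ (λ a → parent a ↑ˡ m) , (λ _ → Fin.zero) ]′ (splitAt t i)

  extBag : Fin (suc t + m) → List (Fin m)
  extBag z = [ bag , (λ w → [ w ]-unless covered? w) ]′ (splitAt (suc t) z)

  extParent-old : ∀ a → extParent (a ↑ˡ m) ≡ parent a ↑ˡ m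
  extParent-old a rewrite splitAt-↑ˡ t a m = refl

  extParent-leaf : ∀ w → extParent (t ↑ʳ w) ≡ Fin.zero
  extParent-leaf w rewrite splitAt-↑ʳ t m w = refl

  extBag-old : ∀ x → extBag (x ↑ˡ m) ≡ bag x
  extBag-old x rewrite splitAt-↑ˡ (suc t) x m = refl

  extBag-leaf : ∀ w → extBag (suc t ↑ʳ w) ≡ [ w ]-unless covered? w
  extBag-leaf w rewrite splitAt-↑ʳ (suc t) m w = refl

  extParent≤ : ∀ i → toℕ (extParent i) ≤ toℕ i
  extParent≤ i with splitView t i
  ... | inˡ a = begin
    toℕ (extParent (a ↑ˡ m))  ≡⟨ cong toℕ (extParent-old a) ⟩
    toℕ (parent a ↑ˡ m)       ≡⟨ toℕ-↑ˡ (parent a) m ⟩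
    toℕ (parent a)            ≤⟨ parent≤ a ⟩
    toℕ a                     ≡⟨ toℕ-↑ˡ a m ⟨
    toℕ (a ↑ˡ m)              ∎
    where open Data.Nat.Properties.≤-Reasoning
  ... | inʳ w = subst (λ r → toℕ r ≤ toℕ (t ↑ʳ w)) (sym (extParent-leaf w)) z≤n

  TreeAdj-old : ∀ {x y} → TreeAdj parent x y → TreeAdj extParent (x ↑ˡ m) (y ↑ˡ m)
  TreeAdj-old (i , inj₁ (refl , refl)) = i ↑ˡ m , inj₁ (refl , sym (extParent-old i))
  TreeAdj-old (i , inj₂ (refl , refl)) = i ↑ˡ m , inj₂ (refl , sym (extParent-old i))

  toOld : ∀ {v x} → v ∈ extBag (x ↑ˡ m) → v ∈ bag x
  toOld {v} {x} = subst (v ∈_) (extBag-old x)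

  fromOld : ∀ {v x} → v ∈ bag x → v ∈ extBag (x ↑ˡ m)
  fromOld {v} {x} = subst (v ∈_) (sym (extBag-old x))

  inLeaf : ∀ {v w} → v ∈ extBag (suc t ↑ʳ w) → v ≡ w × ¬ (∃ λ x → w ∈ bag x)
  inLeaf {v} {w} v∈w = ∈-unless (covered? w) (subst (v ∈_) (extBag-leaf w) v∈w)

  extBagSize : ∀ z → length (extBag z) ≤ suc K
  extBagSize z with splitView (suc t) z
  ... | inˡ x = subst (λ l → length l ≤ suc K) (sym (extBag-old x)) (bagSize x)
  ... | inʳ w = subst (λ l → length l ≤ suc K) (sym (extBag-leaf w))
                      (≤-trans (length-unless (covered? w)) (s≤s z≤n))

  extCovers : ∀ v → ∃ λ z → v ∈ extBag z
  extCovers v with covered? v in eq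
  ... | yes (x , v∈x) = x ↑ˡ m , fromOld v∈x
  ... | no _ = suc t ↑ʳ v , subst (v ∈_) (sym (extBag-leaf v))
                              (subst (λ d → v ∈ [ v ]-unless d) (sym eq) (here refl))

  extSubtree : ∀ v x y → v ∈ extBag x → v ∈ extBag y →
               Walk (TreeAdj extParent) (λ z → v ∈ extBag z) x y
  extSubtree v x y = go (splitView (suc t) x) (splitView (suc t) y)
    where
    go : ∀ {x y} → SplitView (suc t) m x → SplitView (suc t) m y → v ∈ extBag x → v ∈ extBag y →
         Walk (TreeAdj extParent) (λ z → v ∈ extBag z) x y
    go (inˡ a) (inˡ b) v∈a v∈b = mapWalk (_↑ˡ m) TreeAdj-old fromOld (subtree v a b (toOld v∈a) (toOld v∈b))
    go (inˡ a) (inʳ w) v∈a v∈w with inLeaf v∈w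
    ... | refl , uncovered = ⊥-elim (uncovered (a , toOld v∈a))
    go (inʳ w) (inˡ b) v∈w v∈b with inLeaf v∈w
    ... | refl , uncovered = ⊥-elim (uncovered (b , toOld v∈b))
    go (inʳ w) (inʳ w′) v∈w v∈w′ with inLeaf v∈w | inLeaf v∈w′
    ... | refl , _ | refl , _ = stop v∈w

  completeDecomposition : TreeDecomposition Adj K
  completeDecomposition = record
    { t        = t + m
    ; parent   = extParent
    ; parent≤  = extParent≤
    ; bag      = extBag
    ; bagSize  = extBagSize
    ; covers   = extCovers
    ; edgeBag  = λ u v uv → let x , u∈x , v∈x = edgeBag u v uv in x ↑ˡ m , fromOld u∈x , fromOld v∈x
    ; subtree  = extSubtree
    }

Adjacent : {A : Set} → List A → A → A → Set
Adjacent xs x y = Consec xs x y ⊎ Consec xs y x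

Adjacent-sym : {A : Set} {xs : List A} {x y : A} → Adjacent xs x y → Adjacent xs y x
Adjacent-sym = Sum.swap

Consec-++⁺ˡ : {A : Set} {xs : List A} (ys : List A) {x y : A} → Consec xs x y → Consec (xs ++ ys) x y
Consec-++⁺ˡ ys here      = here
Consec-++⁺ˡ ys (there c) = there (Consec-++⁺ˡ ys c)

Consec-last : {A : Set} (a : A) (xs : List A) (b : A) → ∃ λ z → z ∈ a ∷ xs × Consec (a ∷ xs ++ [ b ]) z b
Consec-last a []       b = a , here refl , here
Consec-last a (x ∷ xs) b with Consec-last x xs b
... | z , z∈ , c = z , there z∈ , there c

walkToHead : {A : Set} {Q : A → Set} {z : A} {zs : List A} → (∀ {x} → x ∈ z ∷ zs → Q x) →
             ∀ {x} → x ∈ z ∷ zs → Walk (Adjacent (z ∷ zs)) Q x z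
walkToHead q (here refl) = stop (q (here refl))
walkToHead {zs = z′ ∷ zs} q (there x∈) =
  mapWalk id (Sum.map there there) id (walkToHead (q ∘ there) x∈) ◅◅
  step (q (there (here refl))) (inj₂ here) (stop (q (here refl)))

walkWithin : {A : Set} {Q : A → Set} {xs : List A} → (∀ {x} → x ∈ xs → Q x) →
             ∀ {x y} → x ∈ xs → y ∈ xs → Walk (Adjacent xs) Q x y
walkWithin {xs = _ ∷ _} q x∈ y∈ = walkToHead q x∈ ◅◅ reverseWalk Adjacent-sym (walkToHead q y∈)

module _ {G : Graph} (D : Drawing G) where
  open Graph G
  open Drawing D

  crossingEdges : Fin c → List (Fin m)
  crossingEdges j = cr₁ j ∷ cr₂ j ∷ []

  ∈along⇒∈crossingEdges : ∀ {e j} → j ∈ along e → e ∈ crossingEdges j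
  ∈along⇒∈crossingEdges {e} {j} j∈e with Equivalence.to (alongOK e j) j∈e
  ... | inj₁ refl = here refl
  ... | inj₂ refl = there (here refl)

  ∈crossingEdges⇒∈along : ∀ {e j} → e ∈ crossingEdges j → j ∈ along e
  ∈crossingEdges⇒∈along {e} {j} (here refl)         = Equivalence.from (alongOK e j) (inj₁ refl)
  ∈crossingEdges⇒∈along {e} {j} (there (here refl)) = Equivalence.from (alongOK e j) (inj₂ refl)

  PAdj-sym : ∀ {x y} → PAdj D x y → PAdj D y x
  PAdj-sym (e , xy) = e , Adjacent-sym xy

  -- edgePath e is definitionally  initialSegment e ++ [ inj₁ (tgt e) ]
  initialSegment : Fin m → List (PVertex D)
  initialSegment e = inj₁ (src e) ∷ map inj₂ (along e)

  interior : Fin m → List (PVertex D)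
  interior e = map inj₂ (along e)

  PAdj-initialSegment : ∀ e {x y} → Adjacent (initialSegment e) x y → PAdj D x y
  PAdj-initialSegment e xy = e , Sum.map (Consec-++⁺ˡ _) (Consec-++⁺ˡ _) xy

  PAdj-interior : ∀ e {x y} → Adjacent (interior e) x y → PAdj D x y
  PAdj-interior e xy = e , Sum.map (there ∘ Consec-++⁺ˡ _) (there ∘ Consec-++⁺ˡ _) xy

  carriedByG : PVertex D → List (Fin n)
  carriedByG (inj₁ v) = [ v ]
  carriedByG (inj₂ j) = map src (crossingEdges j)

  src-carriedByG : ∀ e {z} → z ∈ initialSegment e → src e ∈ carriedByG z
  src-carriedByG e (here refl) = here refl
  src-carriedByG e (there z∈) with ∈-map⁻ inj₂ z∈
  ... | j , j∈e , refl = ∈-map⁺ src (∈along⇒∈crossingEdges j∈e)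

  walkToCarriedVertex : ∀ w p → w ∈ carriedByG p → Walk (PAdj D) (λ z → w ∈ carriedByG z) p (inj₁ w)
  walkToCarriedVertex w (inj₁ v) (here refl) = stop (here refl)
  walkToCarriedVertex w (inj₂ j) w∈j with ∈-map⁻ src w∈j
  ... | e , e∈j , refl =
    mapWalk id (PAdj-initialSegment e) id
      (walkWithin (src-carriedByG e) (there (∈-map⁺ inj₂ (∈crossingEdges⇒∈along e∈j))) (here refl))

  edgeTouchesG : ∀ e → ∃₂ λ p q → src e ∈ carriedByG p × tgt e ∈ carriedByG q × PAdj D p q
  edgeTouchesG e with Consec-last (inj₁ (src e)) (map inj₂ (along e)) (inj₁ (tgt e))
  ... | p , p∈ , c = p , inj₁ (tgt e) , src-carriedByG e p∈ , here refl , e , inj₁ c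

  modelOfG : Model (PAdj D) (GAdj G) 2
  modelOfG = record
    { carried         = carriedByG
    ; load            = λ { (inj₁ _) → s≤s z≤n ; (inj₂ _) → s≤s (s≤s z≤n) }
    ; branchConnected = λ w p q w∈p w∈q →
        walkToCarriedVertex w p w∈p ◅◅ reverseWalk PAdj-sym (walkToCarriedVertex w q w∈q)
    ; branchesTouch   = touch
    }
    where
    touch : ∀ u v → GAdj G u v →
            ∃₂ λ p q → u ∈ carriedByG p × v ∈ carriedByG q × (p ≡ q ⊎ PAdj D p q)
    touch _ _ (e , inj₁ (refl , refl)) with edgeTouchesG e
    ... | p , q , u∈p , v∈q , pq = p , q , u∈p , v∈q , inj₂ pq
    touch _ _ (e , inj₂ (refl , refl)) with edgeTouchesG e
    ... | p , q , v∈p , u∈q , pq = q , p , u∈q , v∈p , inj₂ (PAdj-sym pq)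

  carriedByX : PVertex D → List (Fin m)
  carriedByX (inj₁ _) = []
  carriedByX (inj₂ j) = crossingEdges j

  carriedByX⇒∈interior : ∀ {e} p → e ∈ carriedByX p → p ∈ interior e
  carriedByX⇒∈interior (inj₂ j) e∈j = ∈-map⁺ inj₂ (∈crossingEdges⇒∈along e∈j)

  ∈interior⇒carriedByX : ∀ {e z} → z ∈ interior e → e ∈ carriedByX z
  ∈interior⇒carriedByX z∈ with ∈-map⁻ inj₂ z∈
  ... | j , j∈e , refl = ∈along⇒∈crossingEdges j∈e

  modelOfX : Model (PAdj D) (XAdj D) 2
  modelOfX = record
    { carried         = carriedByX
    ; load            = λ { (inj₁ _) → z≤n ; (inj₂ _) → s≤s (s≤s z≤n) }
    ; branchConnected = λ e p q e∈p e∈q →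
        mapWalk id (PAdj-interior e) id
          (walkWithin ∈interior⇒carriedByX (carriedByX⇒∈interior p e∈p) (carriedByX⇒∈interior q e∈q))
    ; branchesTouch   = λ
        { _ _ (j , inj₁ (refl , refl)) → inj₂ j , inj₂ j , here refl , there (here refl) , inj₁ refl
        ; _ _ (j , inj₂ (refl , refl)) → inj₂ j , inj₂ j , there (here refl) , here refl , inj₁ refl
        }
    }

lemma8 : (G : Graph) (D : Drawing G) (k : ℕ) →
    TwAtMost (PAdj D) k →
    TwAtMost (GAdj G) (2 * k + 1) × TwAtMost (XAdj D) (2 * k + 1)
lemma8 G D k T =
  completeDecomposition (carriedDecomposition T (modelOfG D) doubledWidth) ,
  completeDecomposition (carriedDecomposition T (modelOfX D) doubledWidth)
  where
  doubledWidth : 2 * suc k ≤ suc (2 * k + 1)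
  doubledWidth = ≤-reflexive (trans (*-suc 2 k) (cong suc (+-comm 1 (2 * k))))
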